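{- If $F$ is a forest and $k\ge 1$ is an integer, then $\nu(F,\mathcal{C}_k)\ge 1-(k+1)^{ -1}$.
   Context: For a class $\Gamma$ of graphs and a graph $G$, $\nu(G,\Gamma)=\max\{|S| : S\subseteq V(G),\ G[S]\in\Gamma\}/|G|$, where $G[S]$ is the induced subgraph and $|G|$ the number of vertices (the empty graph counts as a member of $\Gamma$). $\mathcal{C}_k$ is the class of graphs all of whose connected components have at most $k$ vertices. -}

module Defs where

open import Data.Nat using (ℕ; suc; _≤_)
open import Data.Bool using (Bool; true; false)
open import Data.Fin using (Fin)
open import Data.Fin.Subset using (Subset; _∈_)
open import Data.List using (List; []; _∷_; length; last)
open import Data.List.Relation.Unary.Unique.Propositional using (Unique)
open import Data.List.Relation.Unary.All using (All)
open import Data.Maybe using (just)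
open import Data.Product using (∃; _×_)
open import Relation.Binary.PropositionalEquality using (_≡_)
open import Relation.Nullary using (¬_)

record Graph (n : ℕ) : Set where
  field
    adj   : Fin n → Fin n → Bool
    sym   : ∀ u v → adj u v ≡ adj v u
    irrefl : ∀ v → adj v v ≡ false
open Graph public

Adj : ∀ {n} → Graph n → Fin n → Fin n → Set
Adj G u v = adj G u v ≡ true

data Chain {n} (G : Graph n) : List (Fin n) → Set where
  nil  : Chain G []
  one  : ∀ v → Chain G (v ∷ [])
  cons : ∀ u v vs → Adj G u v → Chain G (v ∷ vs) → Chain G (u ∷ v ∷ vs)

-- A cycle: at least three distinct vertices v₀ … v_{m-1}, consecutive ones
-- adjacent and v_{m-1} adjacent to v₀.
record Cycle {n} (G : Graph n) : Set where
  field
    v₀ v₁ v₂ : Fin n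
    rest     : List (Fin n)
    distinct : Unique (v₀ ∷ v₁ ∷ v₂ ∷ rest)
    chain    : Chain G (v₀ ∷ v₁ ∷ v₂ ∷ rest)
    closing  : ∃ λ w → last (v₂ ∷ rest) ≡ just w × Adj G w v₀

Forest : ∀ {n} → Graph n → Set
Forest G = ¬ Cycle G

data ConnIn {n} (G : Graph n) (S : Subset n) : Fin n → Fin n → Set where
  here : ∀ {v} → v ∈ S → ConnIn G S v v
  step : ∀ {u w v} → u ∈ S → Adj G u w → ConnIn G S w v → ConnIn G S u v

-- G[S] ∈ 𝒞ₖ : every connected component of G[S] has at most k vertices,
-- i.e. for every v ∈ S, any list of distinct vertices in the component of v
-- has length ≤ k.
InducedInC : ∀ {n} → ℕ → Graph n → Subset n → Set
InducedInC {n} k G S =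
  ∀ v → v ∈ S → (xs : List (Fin n)) → Unique xs →
  All (ConnIn G S v) xs → length xs ≤ k

module Submission where

-- The proof peels the forest from its leaves.  The unprocessed vertices U are
-- grouped into bags, each attached to a representative v (encoded by a
-- labelling r : vertex ↦ representative); a bag is in 𝒞ₖ and touches the rest
-- of U only through v, so representatives carry all edges between bags and
-- form an induced forest.  A leaf v of that forest is treated as follows:
--   * if its bag has ≥ k vertices, remove v and its bag from U and keep the bag
--     (k + 1 or more vertices processed, at most one discarded);
--   * if its bag is smaller and v has a representative neighbour u, merge v
--     and its bag into the bag of u (still at most k per component);
--   * otherwise v with its bag is a whole component of size ≤ k: keep it all.

open import Defs hiding (sym)
open import Data.Nat using (ℕ; zero; suc; _+_; _*_; _≤_; _<_; z≤n; s≤s; _≤?_)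
open import Data.Nat.Properties
  using ( +-suc; +-comm; *-suc; *-distribˡ-+; +-mono-≤; +-monoˡ-≤; *-monoˡ-≤
        ; ≤-trans; ≤-pred; n≤1+n; m≤m+n; <⇒≱; ≰⇒>; module ≤-Reasoning )
open import Data.Bool using (true)
import Data.Bool as Bool
open import Data.Fin using (Fin)
open import Data.Fin.Properties using (_≟_; any?)
open import Data.Fin.Subset
  using (Subset; _∈_; _∉_; _⊆_; _∪_; _∩_; _─_; _-_; ⁅_⁆; ∣_∣; ⊤; inside; outside)
open import Data.Fin.Subset.Properties
  using ( _∈?_; nonempty?; drop-∷-⊆; ∈⊤; ∣⊤∣≡n; ∣p∣≤n; x∈⁅y⁆⇒x≡y; x∉⁅y⁆⇒x≢y; ∣⁅x⁆∣≡1
        ; p⊆q⇒∣p∣≤∣q∣; x∈p∩q⁺; x∈p∩q⁻; x∈p∪q⁺; x∈p∪q⁻; p─q⊆p; x∈p∧x∉q⇒x∈p─q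
        ; x∈p∧x≢y⇒x∈p-y; x∈p⇒∣p-x∣<∣p∣ )
open import Data.Vec using (_∷_; []; tabulate; here; there)
open import Data.Vec.Properties using (lookup⇒[]=; []=⇒lookup; lookup∘tabulate)
open import Data.List using (List; []; _∷_; _++_; _∷ʳ_; length; last)
open import Data.List.Properties using (++-assoc)
open import Data.List.Relation.Unary.All using (All; []; _∷_)
import Data.List.Relation.Unary.All as All
open import Data.List.Relation.Unary.All.Properties using (++⁻ˡ; ¬Any⇒All¬)
open import Data.List.Relation.Unary.AllPairs using ([]; _∷_)
open import Data.List.Relation.Unary.Unique.Propositional using (Unique)
open import Data.List.Membership.Propositional.Properties using (∈-∃++)
open import Data.Maybe using (just)
open import Data.Product using (Σ; ∃; _×_; _,_; proj₁; proj₂)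
open import Data.Sum using (_⊎_; inj₁; inj₂)
open import Data.Empty using (⊥-elim)
open import Function using (id)
open import Relation.Nullary using (¬_; Dec; yes; no; does)
open import Relation.Nullary.Decidable using (_×-dec_; ¬?)
open import Relation.Unary using (Pred; Decidable)
open import Relation.Binary.PropositionalEquality
  using (_≡_; _≢_; refl; sym; trans; cong; subst; module ≡-Reasoning)

private
  variable
    n : ℕ

x∈p─q⇒x∉q : ∀ {p q : Subset n} {x} → x ∈ p ─ q → x ∉ q
x∈p─q⇒x∉q {p = _ ∷ _} {outside ∷ _} here ()
x∈p─q⇒x∉q {p = _ ∷ _} {_ ∷ _} (there x∈diff) (there x∈q) = x∈p─q⇒x∉q x∈diff x∈q

∣∪∣-disjoint : ∀ (p q : Subset n) → (∀ {x} → x ∈ p → x ∉ q) → ∣ p ∪ q ∣ ≡ ∣ p ∣ + ∣ q ∣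
∣∪∣-disjoint [] [] _ = refl
∣∪∣-disjoint (inside ∷ p) (inside ∷ q) disj = ⊥-elim (disj here here)
∣∪∣-disjoint (inside ∷ p) (outside ∷ q) disj =
  cong suc (∣∪∣-disjoint p q (λ x∈p x∈q → disj (there x∈p) (there x∈q)))
∣∪∣-disjoint (outside ∷ p) (inside ∷ q) disj =
  trans (cong suc (∣∪∣-disjoint p q (λ x∈p x∈q → disj (there x∈p) (there x∈q))))
        (sym (+-suc ∣ p ∣ ∣ q ∣))
∣∪∣-disjoint (outside ∷ p) (outside ∷ q) disj =
  ∣∪∣-disjoint p q (λ x∈p x∈q → disj (there x∈p) (there x∈q))

∣─∣-split : ∀ (p q : Subset n) → q ⊆ p → ∣ p ∣ ≡ ∣ p ─ q ∣ + ∣ q ∣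
∣─∣-split [] [] _ = refl
∣─∣-split (s ∷ p) (inside ∷ q) q⊆p with q⊆p here
... | here = trans (cong suc (∣─∣-split p q (drop-∷-⊆ q⊆p))) (sym (+-suc ∣ p ─ q ∣ ∣ q ∣))
∣─∣-split (inside ∷ p) (outside ∷ q) q⊆p = cong suc (∣─∣-split p q (drop-∷-⊆ q⊆p))
∣─∣-split (outside ∷ p) (outside ∷ q) q⊆p = ∣─∣-split p q (drop-∷-⊆ q⊆p)

∣p∣≡1+∣p-x∣ : ∀ (p : Subset n) {x} → x ∈ p → ∣ p ∣ ≡ suc ∣ p - x ∣
∣p∣≡1+∣p-x∣ p {x} x∈p = begin
  ∣ p ∣               ≡⟨ ∣─∣-split p ⁅ x ⁆ (λ {y} y∈⁅x⁆ → subst (_∈ p) (sym (x∈⁅y⁆⇒x≡y x y∈⁅x⁆)) x∈p) ⟩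
  ∣ p - x ∣ + ∣ ⁅ x ⁆ ∣ ≡⟨ cong (∣ p - x ∣ +_) (∣⁅x⁆∣≡1 x) ⟩
  ∣ p - x ∣ + 1       ≡⟨ +-comm ∣ p - x ∣ 1 ⟩
  suc ∣ p - x ∣       ∎
  where open ≡-Reasoning

⊆-x⇒∣p∣<∣q∣ : ∀ {p q : Subset n} {x} → p ⊆ q - x → x ∈ q → ∣ p ∣ < ∣ q ∣
⊆-x⇒∣p∣<∣q∣ p⊆q-x x∈q = ≤-trans (s≤s (p⊆q⇒∣p∣≤∣q∣ p⊆q-x)) (x∈p⇒∣p-x∣<∣p∣ x∈q)

unique⇒length≤∣p∣ : ∀ (p : Subset n) xs → Unique xs → All (_∈ p) xs → length xs ≤ ∣ p ∣
unique⇒length≤∣p∣ p [] _ _ = z≤n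
unique⇒length≤∣p∣ p (x ∷ xs) (x∉xs ∷ unique) (x∈p ∷ xs⊆p) =
  ≤-trans (s≤s (unique⇒length≤∣p∣ (p - x) xs unique xs⊆p-x)) (x∈p⇒∣p-x∣<∣p∣ x∈p)
  where
  xs⊆p-x : All (_∈ p - x) xs
  xs⊆p-x = All.map (λ (y∈p , x≢y) → x∈p∧x≢y⇒x∈p-y y∈p (λ y≡x → x≢y (sym y≡x)))
                   (All.zip (xs⊆p , x∉xs))

unique⇒length≤n : ∀ (xs : List (Fin n)) → Unique xs → length xs ≤ n
unique⇒length≤n {n} xs unique =
  subst (length xs ≤_) (∣⊤∣≡n n) (unique⇒length≤∣p∣ ⊤ xs unique (All.universal (λ _ → ∈⊤) xs))

subsetOf : ∀ {ℓ} {P : Pred (Fin n) ℓ} → Decidable P → Subset n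
subsetOf P? = tabulate (λ x → does (P? x))

module _ {ℓ} {P : Pred (Fin n) ℓ} (P? : Decidable P) where

  ∈subsetOf⁺ : ∀ {x} → P x → x ∈ subsetOf P?
  ∈subsetOf⁺ {x} px = lookup⇒[]= x (subsetOf P?) (trans (lookup∘tabulate _ x) (holds (P? x) px))
    where
    holds : (d : Dec (P x)) → P x → does d ≡ true
    holds (yes _) _ = refl
    holds (no ¬px) px = ⊥-elim (¬px px)

  ∈subsetOf⁻ : ∀ {x} → x ∈ subsetOf P? → P x
  ∈subsetOf⁻ {x} x∈ = witness (P? x) (trans (sym (lookup∘tabulate _ x)) ([]=⇒lookup x∈))
    where
    witness : (d : Dec (P x)) → does d ≡ true → P x
    witness (yes px) _ = px

module _ (G : Graph n) where

  adj-sym : ∀ {u v} → Adj G u v → Adj G v u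
  adj-sym {u} {v} uv = trans (Graph.sym G v u) uv

  adj⇒≢ : ∀ {u v} → Adj G u v → u ≢ v
  adj⇒≢ {u} uu refl with () ← trans (sym uu) (Graph.irrefl G u)

  Adj? : ∀ u v → Dec (Adj G u v)
  Adj? u v = adj G u v Bool.≟ true

module Components (G : Graph n) (k : ℕ) where

  conn-end : ∀ {S u v} → ConnIn G S u v → v ∈ S
  conn-end (here v∈S) = v∈S
  conn-end (step _ _ path) = conn-end path

  conn-start : ∀ {S u v} → ConnIn G S u v → u ∈ S
  conn-start (here u∈S) = u∈S
  conn-start (step u∈S _ _) = u∈S

  conn-mono : ∀ {S T u v} → S ⊆ T → ConnIn G S u v → ConnIn G T u v
  conn-mono S⊆T (here v∈S) = here (S⊆T v∈S)
  conn-mono S⊆T (step u∈S uw path) = step (S⊆T u∈S) uw (conn-mono S⊆T path)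

  conn-closed : ∀ {P T u v} → (∀ {x y} → x ∈ P → y ∈ T → Adj G x y → y ∈ P) →
                u ∈ P → ConnIn G T u v → ConnIn G P u v
  conn-closed closed u∈P (here _) = here u∈P
  conn-closed closed u∈P (step _ uw path) =
    step u∈P uw (conn-closed closed (closed u∈P (conn-start path) uw) path)

  inC-mono : ∀ {S T} → S ⊆ T → InducedInC k G T → InducedInC k G S
  inC-mono S⊆T T-ok v v∈S xs unique conn = T-ok v (S⊆T v∈S) xs unique (All.map (conn-mono S⊆T) conn)

  inC-small : ∀ {S} → ∣ S ∣ ≤ k → InducedInC k G S
  inC-small {S} S≤k v _ xs unique conn = ≤-trans (unique⇒length≤∣p∣ S xs unique (All.map conn-end conn)) S≤k

  Separated : Subset n → Subset n → Set
  Separated P Q = ∀ {x y} → x ∈ P → y ∈ Q → ¬ Adj G x y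

  -- A union of two separated members of 𝒞ₖ is in 𝒞ₖ: each component lies in one side.
  inC-∪ : ∀ {P Q} → Separated P Q → InducedInC k G P → InducedInC k G Q → InducedInC k G (P ∪ Q)
  inC-∪ {P} {Q} sep P-ok Q-ok v v∈P∪Q xs unique conn with x∈p∪q⁻ P Q v∈P∪Q
  ... | inj₁ v∈P = P-ok v v∈P xs unique (All.map (conn-closed closedP v∈P) conn)
    where
    closedP : ∀ {x y} → x ∈ P → y ∈ P ∪ Q → Adj G x y → y ∈ P
    closedP x∈P y∈P∪Q xy with x∈p∪q⁻ P Q y∈P∪Q
    ... | inj₁ y∈P = y∈P
    ... | inj₂ y∈Q = ⊥-elim (sep x∈P y∈Q xy)
  ... | inj₂ v∈Q = Q-ok v v∈Q xs unique (All.map (conn-closed closedQ v∈Q) conn)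
    where
    closedQ : ∀ {x y} → x ∈ Q → y ∈ P ∪ Q → Adj G x y → y ∈ Q
    closedQ x∈Q y∈P∪Q xy with x∈p∪q⁻ P Q y∈P∪Q
    ... | inj₁ y∈P = ⊥-elim (sep y∈P x∈Q (adj-sym G xy))
    ... | inj₂ y∈Q = y∈Q

-- Every nonempty vertex set A of a forest contains a vertex with at most one
-- neighbour in A.  A maximal path inside A ends in such a vertex: a second
-- neighbour off the path would extend it, one on the path would close a cycle.
module Leaves (G : Graph n) (forest : Forest G) where

  LeafOf : Subset n → Fin n → Set
  LeafOf A v = ∀ {y z} → y ∈ A → z ∈ A → Adj G v y → Adj G v z → y ≡ z

  chain-prefix : ∀ xs ys → Chain G (xs ++ ys) → Chain G xs
  chain-prefix [] _ _ = nil
  chain-prefix (x ∷ []) _ _ = one x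
  chain-prefix (x ∷ y ∷ xs) ys (cons _ _ _ xy chain) = cons x y xs xy (chain-prefix (y ∷ xs) ys chain)

  unique-prefix : ∀ (xs ys : List (Fin n)) → Unique (xs ++ ys) → Unique xs
  unique-prefix [] _ _ = []
  unique-prefix (x ∷ xs) ys (x∉ ∷ unique) = ++⁻ˡ xs x∉ ∷ unique-prefix xs ys unique

  last-∷ʳ : ∀ (x : Fin n) xs w → last (x ∷ xs ∷ʳ w) ≡ just w
  last-∷ʳ x [] w = refl
  last-∷ʳ x (y ∷ xs) w = last-∷ʳ y xs w

  closing-cycle : ∀ x₀ x₁ ys w zs → Unique (x₀ ∷ x₁ ∷ ys ++ w ∷ zs) →
                  Chain G (x₀ ∷ x₁ ∷ ys ++ w ∷ zs) → Adj G x₀ w → Cycle G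
  closing-cycle x₀ x₁ ys w zs unique chain x₀w = cycle ys
                  (unique-prefix cyc zs (subst Unique path≡ unique))
                  (chain-prefix cyc zs (subst (Chain G) path≡ chain))
    where
    cyc : List (Fin n)
    cyc = x₀ ∷ x₁ ∷ ys ∷ʳ w
    path≡ : x₀ ∷ x₁ ∷ ys ++ w ∷ zs ≡ cyc ++ zs
    path≡ = cong (λ l → x₀ ∷ x₁ ∷ l) (sym (++-assoc ys (w ∷ []) zs))
    cycle : ∀ ys → Unique (x₀ ∷ x₁ ∷ ys ∷ʳ w) → Chain G (x₀ ∷ x₁ ∷ ys ∷ʳ w) → Cycle G
    cycle [] u c = record { v₀ = x₀ ; v₁ = x₁ ; v₂ = w ; rest = [] ; distinct = u ; chain = c
                          ; closing = w , refl , adj-sym G x₀w }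
    cycle (y ∷ ys) u c = record { v₀ = x₀ ; v₁ = x₁ ; v₂ = y ; rest = ys ∷ʳ w ; distinct = u ; chain = c
                                ; closing = w , last-∷ʳ y ys w , adj-sym G x₀w }

  module _ (A : Subset n) where
    open import Data.List.Membership.DecPropositional (_≟_ {n}) using () renaming (_∈?_ to _∈ₗ?_)

    -- Extend the path x₀ x₁ … (inside A at its head x₀) until its head is a leaf of A;
    -- the fuel runs out only if the path outgrows the n available vertices.
    extend : ∀ fuel x₀ x₁ rest → x₀ ∈ A → Unique (x₀ ∷ x₁ ∷ rest) → Chain G (x₀ ∷ x₁ ∷ rest) →
             n ≤ fuel + length (x₀ ∷ x₁ ∷ rest) → ∃ λ v → v ∈ A × LeafOf A v
    extend fuel x₀ x₁ rest x₀∈A unique chain bound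
      with any? (λ w → (w ∈? A) ×-dec Adj? G x₀ w ×-dec ¬? (w ≟ x₁))
    ... | no noOther = x₀ , x₀∈A , λ y∈A z∈A x₀y x₀z → trans (onlyX₁ y∈A x₀y) (sym (onlyX₁ z∈A x₀z))
      where
      onlyX₁ : ∀ {y} → y ∈ A → Adj G x₀ y → y ≡ x₁
      onlyX₁ {y} y∈A x₀y with y ≟ x₁
      ... | yes y≡x₁ = y≡x₁
      ... | no y≢x₁ = ⊥-elim (noOther (y , y∈A , x₀y , y≢x₁))
    ... | yes (w , w∈A , x₀w , w≢x₁) with w ∈ₗ? rest
    ...   | yes w∈rest with ∈-∃++ w∈rest
    ...     | ys , zs , refl = ⊥-elim (forest (closing-cycle x₀ x₁ ys w zs unique chain x₀w))
    extend fuel x₀ x₁ rest x₀∈A unique chain bound | yes (w , w∈A , x₀w , w≢x₁) | no w∉rest =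
      grow fuel bound
      where
      unique′ : Unique (w ∷ x₀ ∷ x₁ ∷ rest)
      unique′ = ((λ w≡x₀ → adj⇒≢ G x₀w (sym w≡x₀)) ∷ w≢x₁ ∷ ¬Any⇒All¬ rest w∉rest) ∷ unique
      grow : ∀ fuel → n ≤ fuel + length (x₀ ∷ x₁ ∷ rest) → ∃ λ v → v ∈ A × LeafOf A v
      grow zero bound = ⊥-elim (<⇒≱ (unique⇒length≤n _ unique′) bound)
      grow (suc fuel) bound = extend fuel w x₀ (x₁ ∷ rest) w∈A unique′
        (cons w x₀ (x₁ ∷ rest) (adj-sym G x₀w) chain) (subst (n ≤_) (sym (+-suc fuel _)) bound)

    leaf-exists : ∀ {a} → a ∈ A → ∃ λ v → v ∈ A × LeafOf A v
    leaf-exists {a} a∈A with any? (λ w → (w ∈? A) ×-dec Adj? G a w)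
    ... | no isolated = a , a∈A , λ y∈A _ ay _ → ⊥-elim (isolated (_ , y∈A , ay))
    ... | yes (w , w∈A , aw) =
      extend n w a [] w∈A (((λ w≡a → adj⇒≢ G aw (sym w≡a)) ∷ []) ∷ [] ∷ [])
             (cons w a [] (adj-sym G aw) (one a)) (m≤m+n n 2)

-- The peeling process.  A labelling r sends every vertex of the unprocessed set U
-- to the representative of its bag; the bag's fiber is {x ∈ U | r x ≡ v}.
module Peeling (F : Graph n) (forest : Forest F) (k : ℕ) where
  open Components F k
  open Leaves F forest

  Labelling : Set
  Labelling = Fin n → Fin n

  -- These sets are used only through the membership lemmas below; keeping them
  -- opaque also lets Agda read the labelling off a fiber.
  opaque
    fiber : Subset n → Labelling → Fin n → Subset n
    fiber U r v = U ∩ subsetOf (λ x → r x ≟ v)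

    bag : Subset n → Labelling → Fin n → Subset n
    bag U r v = fiber U r v - v

    active : Subset n → Labelling → Subset n
    active U r = U ∩ subsetOf (λ x → r x ≟ x)

    ∈fiber⁺ : ∀ {U r x v} → x ∈ U → r x ≡ v → x ∈ fiber U r v
    ∈fiber⁺ {r = r} {v = v} x∈U rx≡v = x∈p∩q⁺ (x∈U , ∈subsetOf⁺ (λ x → r x ≟ v) rx≡v)

    ∈fiber⁻ : ∀ {U r x v} → x ∈ fiber U r v → x ∈ U × r x ≡ v
    ∈fiber⁻ {U} {r} {v = v} x∈ with x∈p∩q⁻ U _ x∈
    ... | x∈U , x∈r⁻¹v = x∈U , ∈subsetOf⁻ (λ x → r x ≟ v) x∈r⁻¹v

    ∈active⁺ : ∀ {U r x} → x ∈ U → r x ≡ x → x ∈ active U r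
    ∈active⁺ {r = r} x∈U rx≡x = x∈p∩q⁺ (x∈U , ∈subsetOf⁺ (λ x → r x ≟ x) rx≡x)

    ∈active⁻ : ∀ {U r x} → x ∈ active U r → x ∈ U × r x ≡ x
    ∈active⁻ {U} {r} x∈ with x∈p∩q⁻ U _ x∈
    ... | x∈U , fixed = x∈U , ∈subsetOf⁻ (λ x → r x ≟ x) fixed

    ∈bag⁺ : ∀ {U r x v} → x ∈ fiber U r v → x ≢ v → x ∈ bag U r v
    ∈bag⁺ = x∈p∧x≢y⇒x∈p-y

    ∈bag⁻ : ∀ {U r x v} → x ∈ bag U r v → x ∈ fiber U r v × x ≢ v
    ∈bag⁻ {v = v} x∈ = p─q⊆p _ ⁅ v ⁆ x∈ , x∉⁅y⁆⇒x≢y (x∈p─q⇒x∉q x∈)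

    ∣fiber∣≡1+∣bag∣ : ∀ {U r v} → v ∈ active U r → ∣ fiber U r v ∣ ≡ suc ∣ bag U r v ∣
    ∣fiber∣≡1+∣bag∣ {U} {r} {v} v∈A with ∈active⁻ {U} {r} v∈A
    ... | v∈U , rv≡v = ∣p∣≡1+∣p-x∣ (fiber U r v) (∈fiber⁺ {U} {r} v∈U rv≡v)

  fiber⊆U : ∀ {U r v} → fiber U r v ⊆ U
  fiber⊆U x∈ = proj₁ (∈fiber⁻ x∈)

  record Invariant (U : Subset n) (r : Labelling) : Set where
    field
      rep-active : ∀ {x} → x ∈ U → r x ∈ active U r
      bag-inC    : ∀ {v} → v ∈ active U r → InducedInC k F (bag U r v)
      bag-closed : ∀ {x y} → x ∈ U → y ∈ U → Adj F x y → r x ≢ x → r y ≡ r x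

  Result : Subset n → Set
  Result U = Σ (Subset n) λ S → S ⊆ U × InducedInC k F S × k * ∣ U ∣ ≤ suc k * ∣ S ∣

  detach : ∀ {U B P} → B ⊆ U → P ⊆ B → InducedInC k F P → Separated P (U ─ B) →
           k * ∣ B ∣ ≤ suc k * ∣ P ∣ → Result (U ─ B) → Result U
  detach {U} {B} {P} B⊆U P⊆B P-ok P-sep B-bound (S , S⊆U─B , S-ok , S-bound) =
    S ∪ P , S∪P⊆U , inC-∪ S-sep S-ok P-ok , bound
    where
    S∪P⊆U : S ∪ P ⊆ U
    S∪P⊆U x∈S∪P with x∈p∪q⁻ S P x∈S∪P
    ... | inj₁ x∈S = p─q⊆p U B (S⊆U─B x∈S)
    ... | inj₂ x∈P = B⊆U (P⊆B x∈P)

    S-sep : Separated S P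
    S-sep x∈S y∈P xy = P-sep y∈P (S⊆U─B x∈S) (adj-sym F xy)

    disjoint : ∀ {x} → x ∈ S → x ∉ P
    disjoint x∈S x∈P = x∈p─q⇒x∉q (S⊆U─B x∈S) (P⊆B x∈P)

    bound : k * ∣ U ∣ ≤ suc k * ∣ S ∪ P ∣
    bound = begin
      k * ∣ U ∣                          ≡⟨ cong (k *_) (∣─∣-split U B B⊆U) ⟩
      k * (∣ U ─ B ∣ + ∣ B ∣)              ≡⟨ *-distribˡ-+ k ∣ U ─ B ∣ ∣ B ∣ ⟩
      k * ∣ U ─ B ∣ + k * ∣ B ∣            ≤⟨ +-mono-≤ S-bound B-bound ⟩
      suc k * ∣ S ∣ + suc k * ∣ P ∣        ≡⟨ sym (*-distribˡ-+ (suc k) ∣ S ∣ ∣ P ∣) ⟩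
      suc k * (∣ S ∣ + ∣ P ∣)              ≡⟨ cong (suc k *_) (sym (∣∪∣-disjoint S P disjoint)) ⟩
      suc k * ∣ S ∪ P ∣                  ∎
      where open ≤-Reasoning

  module _ {U′ U : Subset n} {r : Labelling} (U′⊆U : U′ ⊆ U) where

    fiber-mono : ∀ {v} → fiber U′ r v ⊆ fiber U r v
    fiber-mono x∈ with ∈fiber⁻ x∈
    ... | x∈U′ , rx≡v = ∈fiber⁺ (U′⊆U x∈U′) rx≡v

    bag-mono : ∀ {v} → bag U′ r v ⊆ bag U r v
    bag-mono x∈ with ∈bag⁻ x∈
    ... | x∈fiber , x≢v = ∈bag⁺ (fiber-mono x∈fiber) x≢v

    active-mono : active U′ r ⊆ active U r
    active-mono x∈ with ∈active⁻ x∈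
    ... | x∈U′ , rx≡x = ∈active⁺ (U′⊆U x∈U′) rx≡x

  module _ {U : Subset n} {r : Labelling} (inv : Invariant U r) where
    open Invariant inv

    outgoing : ∀ {v x y} → x ∈ fiber U r v → y ∈ U → y ∉ fiber U r v → Adj F x y →
               x ≡ v × y ∈ active U r
    outgoing {v} {x} {y} x∈fiber y∈U y∉fiber xy = x≡v , y∈A
      where
      x∈U : x ∈ U
      x∈U = proj₁ (∈fiber⁻ x∈fiber)
      rx≡v : r x ≡ v
      rx≡v = proj₂ (∈fiber⁻ x∈fiber)
      different : r y ≢ r x
      different ry≡rx = y∉fiber (∈fiber⁺ y∈U (trans ry≡rx rx≡v))
      x≡v : x ≡ v
      x≡v with r x ≟ x
      ... | yes rx≡x = trans (sym rx≡x) rx≡v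
      ... | no rx≢x = ⊥-elim (different (bag-closed x∈U y∈U xy rx≢x))
      y∈A : y ∈ active U r
      y∈A with r y ≟ y
      ... | yes ry≡y = ∈active⁺ y∈U ry≡y
      ... | no ry≢y = ⊥-elim (different (sym (bag-closed y∈U x∈U (adj-sym F xy) ry≢y)))

    bag-separated : ∀ {v} → Separated (bag U r v) (U ─ fiber U r v)
    bag-separated x∈bag y∈ xy with ∈bag⁻ x∈bag
    ... | x∈fiber , x≢v = x≢v (proj₁ (outgoing x∈fiber (p─q⊆p U _ y∈) (x∈p─q⇒x∉q y∈) xy))

    isolated-separated : ∀ {v} → ¬ (∃ λ u → u ∈ active U r × Adj F v u) →
                         Separated (fiber U r v) (U ─ fiber U r v)
    isolated-separated {v} isolated {x} {y} x∈fiber y∈ xy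
      with outgoing x∈fiber (p─q⊆p U _ y∈) (x∈p─q⇒x∉q y∈) xy
    ... | x≡v , y∈A = isolated (y , y∈A , subst (λ z → Adj F z y) x≡v xy)

    cut-invariant : ∀ v → Invariant (U ─ fiber U r v) r
    cut-invariant v = record
      { rep-active = rep-active′
      ; bag-inC    = λ w∈A → inC-mono (bag-mono U─fiber⊆U) (bag-inC (active-mono U─fiber⊆U w∈A))
      ; bag-closed = λ x∈ y∈ → bag-closed (U─fiber⊆U x∈) (U─fiber⊆U y∈)
      }
      where
      U─fiber⊆U : U ─ fiber U r v ⊆ U
      U─fiber⊆U = p─q⊆p U (fiber U r v)
      rep-active′ : ∀ {x} → x ∈ U ─ fiber U r v → r x ∈ active (U ─ fiber U r v) r
      rep-active′ {x} x∈ with ∈active⁻ (rep-active (U─fiber⊆U x∈))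
      ... | rx∈U , rrx≡rx = ∈active⁺ (x∈p∧x∉q⇒x∈p─q rx∈U rx∉fiber) rrx≡rx
        where
        rx∉fiber : r x ∉ fiber U r v
        rx∉fiber rx∈fiber = x∈p─q⇒x∉q x∈ (∈fiber⁺ (U─fiber⊆U x∈) (trans (sym rrx≡rx) (proj₂ (∈fiber⁻ rx∈fiber))))

  cut-shrinks : ∀ {U r v} → active (U ─ fiber U r v) r ⊆ active U r - v
  cut-shrinks {U} {r} {v} x∈ with ∈active⁻ x∈
  ... | x∈U─fiber , rx≡x =
    x∈p∧x≢y⇒x∈p-y (active-mono (p─q⊆p U _) x∈)
      (λ x≡v → x∈p─q⇒x∉q x∈U─fiber (∈fiber⁺ (p─q⊆p U _ x∈U─fiber) (trans rx≡x x≡v)))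

  -- Relabelling w ↦ u if w ≡ v: merges the fiber of v into the fiber of u.
  move : Fin n → Fin n → Fin n → Fin n
  move v u w with w ≟ v
  ... | yes _ = u
  ... | no _ = w

  move-cases : ∀ v u w → (w ≡ v × move v u w ≡ u) ⊎ (w ≢ v × move v u w ≡ w)
  move-cases v u w with w ≟ v
  ... | yes w≡v = inj₁ (w≡v , refl)
  ... | no w≢v = inj₂ (w≢v , refl)

  move-hit : ∀ v u → move v u v ≡ u
  move-hit v u with move-cases v u v
  ... | inj₁ (_ , moved) = moved
  ... | inj₂ (v≢v , _) = ⊥-elim (v≢v refl)

  module Merge {U : Subset n} {r : Labelling} (inv : Invariant U r)
               {v u : Fin n} (v∈A : v ∈ active U r) (leaf : LeafOf (active U r) v)
               (u∈A : u ∈ active U r) (vu : Adj F v u) where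
    open Invariant inv

    r′ : Labelling
    r′ x = move v u (r x)

    u≢v : u ≢ v
    u≢v u≡v = adj⇒≢ F vu (sym u≡v)

    stays-active : ∀ {w} → w ∈ active U r → w ≢ v → w ∈ active U r′
    stays-active {w} w∈A w≢v with ∈active⁻ w∈A | move-cases v u (r w)
    ... | w∈U , rw≡w | inj₁ (rw≡v , _) = ⊥-elim (w≢v (trans (sym rw≡w) rw≡v))
    ... | w∈U , rw≡w | inj₂ (_ , moved) = ∈active⁺ w∈U (trans moved rw≡w)

    unmoved : ∀ {x w} → r′ x ≡ w → w ≢ u → r x ≡ w
    unmoved {x} r′x≡w w≢u with move-cases v u (r x)
    ... | inj₁ (_ , moved) = ⊥-elim (w≢u (trans (sym r′x≡w) moved))
    ... | inj₂ (_ , moved) = trans (sym moved) r′x≡w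

    v∈fiber : v ∈ fiber U r v
    v∈fiber = ∈fiber⁺ (proj₁ (∈active⁻ v∈A)) (proj₂ (∈active⁻ v∈A))

    r′u≡u : r′ u ≡ u
    r′u≡u = proj₂ (∈active⁻ (stays-active u∈A u≢v))

    neighbour-of-v : ∀ {y} → y ∈ U → Adj F v y → r′ y ≡ u
    neighbour-of-v {y} y∈U vy with y ∈? fiber U r v
    ... | yes y∈fiber = trans (cong (move v u) (proj₂ (∈fiber⁻ y∈fiber))) (move-hit v u)
    ... | no y∉fiber with outgoing inv v∈fiber y∈U y∉fiber vy
    ...   | _ , y∈A = trans (cong r′ (leaf y∈A u∈A vy vu)) r′u≡u

    merged-bag⊆ : bag U r′ u ⊆ bag U r u ∪ fiber U r v
    merged-bag⊆ {x} x∈ with ∈bag⁻ x∈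
    ... | x∈fiber′ , x≢u with ∈fiber⁻ x∈fiber′ | move-cases v u (r x)
    ...   | x∈U , _ | inj₁ (rx≡v , _) = x∈p∪q⁺ (inj₂ (∈fiber⁺ x∈U rx≡v))
    ...   | x∈U , r′x≡u | inj₂ (_ , moved) =
      x∈p∪q⁺ (inj₁ (∈bag⁺ (∈fiber⁺ x∈U (trans (sym moved) r′x≡u)) x≢u))

    bag-u-separated : Separated (bag U r u) (fiber U r v)
    bag-u-separated {x} {y} x∈bag y∈fiber xy with ∈bag⁻ x∈bag
    ... | x∈fiber-u , x≢u = x≢u (proj₁ (outgoing inv x∈fiber-u (fiber⊆U y∈fiber) y∉fiber-u xy))
      where
      y∉fiber-u : y ∉ fiber U r u
      y∉fiber-u y∈fiber-u = u≢v (trans (sym (proj₂ (∈fiber⁻ y∈fiber-u))) (proj₂ (∈fiber⁻ y∈fiber)))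

    merge-invariant : ∣ fiber U r v ∣ ≤ k → Invariant U r′
    merge-invariant small = record
      { rep-active = rep-active′ ; bag-inC = bag-inC′ ; bag-closed = bag-closed′ }
      where
      rep-active′ : ∀ {x} → x ∈ U → r′ x ∈ active U r′
      rep-active′ {x} x∈U with move-cases v u (r x)
      ... | inj₁ (_ , moved) = subst (_∈ active U r′) (sym moved) (stays-active u∈A u≢v)
      ... | inj₂ (rx≢v , moved) = subst (_∈ active U r′) (sym moved) (stays-active (rep-active x∈U) rx≢v)

      bag-inC′ : ∀ {w} → w ∈ active U r′ → InducedInC k F (bag U r′ w)
      bag-inC′ {w} w∈A′ with w ≟ u
      ... | yes refl = inC-mono merged-bag⊆ (inC-∪ bag-u-separated (bag-inC u∈A) (inC-small small))
      ... | no w≢u = inC-mono bag′⊆bag (bag-inC (∈active⁺ w∈U (unmoved r′w≡w w≢u)))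
        where
        w∈U : w ∈ U
        w∈U = proj₁ (∈active⁻ w∈A′)
        r′w≡w : r′ w ≡ w
        r′w≡w = proj₂ (∈active⁻ w∈A′)
        bag′⊆bag : bag U r′ w ⊆ bag U r w
        bag′⊆bag x∈ with ∈bag⁻ x∈
        ... | x∈fiber′ , x≢w = ∈bag⁺ (∈fiber⁺ (proj₁ (∈fiber⁻ x∈fiber′)) (unmoved (proj₂ (∈fiber⁻ x∈fiber′)) w≢u)) x≢w

      bag-closed′ : ∀ {x y} → x ∈ U → y ∈ U → Adj F x y → r′ x ≢ x → r′ y ≡ r′ x
      bag-closed′ {x} {y} x∈U y∈U xy r′x≢x with r x ≟ x
      ... | no rx≢x = cong (move v u) (bag-closed x∈U y∈U xy rx≢x)
      ... | yes rx≡x with move-cases v u (r x)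
      ...   | inj₂ (_ , moved) = ⊥-elim (r′x≢x (trans moved rx≡x))
      ...   | inj₁ (rx≡v , moved) =
        trans (neighbour-of-v y∈U (subst (λ z → Adj F z y) (trans (sym rx≡x) rx≡v) xy)) (sym moved)

    merge-shrinks : active U r′ ⊆ active U r - v
    merge-shrinks {x} x∈ with ∈active⁻ x∈ | move-cases v u (r x)
    ... | x∈U , r′x≡x | inj₁ (rx≡v , moved) =
      ⊥-elim (u≢v (trans (sym (proj₂ (∈active⁻ u∈A))) (trans (cong r (trans (sym moved) r′x≡x)) rx≡v)))
    ... | x∈U , r′x≡x | inj₂ (rx≢v , moved) =
      x∈p∧x≢y⇒x∈p-y (∈active⁺ x∈U rx≡x) (λ x≡v → rx≢v (trans rx≡x x≡v))
      where
      rx≡x : r x ≡ x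
      rx≡x = trans (sym moved) r′x≡x

  heavy-bound : ∀ {U r v} → v ∈ active U r → k ≤ ∣ bag U r v ∣ →
                k * ∣ fiber U r v ∣ ≤ suc k * ∣ bag U r v ∣
  heavy-bound {U} {r} {v} v∈A k≤h = begin
    k * ∣ fiber U r v ∣    ≡⟨ cong (k *_) (∣fiber∣≡1+∣bag∣ v∈A) ⟩
    k * suc h            ≡⟨ *-suc k h ⟩
    k + k * h            ≤⟨ +-monoˡ-≤ (k * h) k≤h ⟩
    suc k * h            ∎
    where
    open ≤-Reasoning
    h : ℕ
    h = ∣ bag U r v ∣

  light-fiber : ∀ {U r v} → v ∈ active U r → ¬ (k ≤ ∣ bag U r v ∣) → ∣ fiber U r v ∣ ≤ k
  light-fiber v∈A light = subst (_≤ k) (sym (∣fiber∣≡1+∣bag∣ v∈A)) (≰⇒> light)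

  peel-leaf : ∀ {U r v} → Invariant U r → v ∈ active U r → LeafOf (active U r) v →
         (∀ {U′ r′} → active U′ r′ ⊆ active U r - v → Invariant U′ r′ → Result U′) → Result U
  peel-leaf {U} {r} {v} inv v∈A leaf recurse with k ≤? ∣ bag U r v ∣
  ... | yes heavy =
    detach fiber⊆U (λ x∈ → proj₁ (∈bag⁻ x∈)) (Invariant.bag-inC inv v∈A) (bag-separated inv)
           (heavy-bound v∈A heavy) (recurse cut-shrinks (cut-invariant inv v))
  ... | no light with any? (λ u → (u ∈? active U r) ×-dec Adj? F v u)
  ...   | yes (u , u∈A , vu) =
    let open Merge inv v∈A leaf u∈A vu in recurse merge-shrinks (merge-invariant (light-fiber v∈A light))
  ...   | no isolated =
    detach fiber⊆U (λ x∈ → x∈) (inC-small (light-fiber v∈A light)) (isolated-separated inv isolated)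
           (*-monoˡ-≤ ∣ fiber U r v ∣ (n≤1+n k)) (recurse cut-shrinks (cut-invariant inv v))

  -- Run the process; each step removes a representative, so ∣active U r∣ is the fuel.
  -- When no representative is left, U itself is empty.
  peel : ∀ fuel U r → ∣ active U r ∣ ≤ fuel → Invariant U r → Result U
  peel fuel U r bound inv with nonempty? (active U r)
  ... | no none = U , (λ x∈ → x∈) , (λ x x∈U → ⊥-elim (none (r x , Invariant.rep-active inv x∈U))) ,
                  *-monoˡ-≤ ∣ U ∣ (n≤1+n k)
  peel zero U r bound inv | yes (a , a∈A) = ⊥-elim (<⇒≱ (x∈p⇒∣p-x∣<∣p∣ a∈A) (≤-trans bound z≤n))
  peel (suc fuel) U r bound inv | yes (a , a∈A) with leaf-exists (active U r) a∈A
  ... | v , v∈A , leaf = peel-leaf inv v∈A leaf λ {U′} {r′} shrinks inv′ →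
    peel fuel U′ r′ (≤-pred (≤-trans (⊆-x⇒∣p∣<∣q∣ shrinks v∈A) bound)) inv′

  initial : Invariant ⊤ id
  initial = record
    { rep-active = λ _ → ∈active⁺ ∈⊤ refl
    ; bag-inC    = λ _ x x∈bag → ⊥-elim (proj₂ (∈bag⁻ x∈bag) (proj₂ (∈fiber⁻ (proj₁ (∈bag⁻ x∈bag)))))
    ; bag-closed = λ _ _ _ not-fixed → ⊥-elim (not-fixed refl)
    }

lemma2 : ∀ (n k : ℕ) → 1 ≤ k → (F : Graph n) → Forest F →
    ∃ λ (S : Subset n) → InducedInC k F S × (k * n ≤ suc k * ∣ S ∣)
lemma2 n k _ F forest with peel n ⊤ id (∣p∣≤n (active ⊤ id)) initial
  where open Peeling F forest k
... | S , _ , S-ok , bound = S , S-ok , subst (λ m → k * m ≤ suc k * ∣ S ∣) (∣⊤∣≡n n) bound
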